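{- Let $G$ be a finite group with identity $\xi$, and let $S$ be a non-empty subset of $G$ with $S=S^{ -1}$ and $\xi\notin S$. Let $d_\Gamma$ be the graph distance in the Cayley graph $\mathrm{Cay}(G,S)$ (vertex set $G$, with $g,h$ adjacent iff $gh^{ -1}\in S$). Let $d\geq 1$ be an integer and let $C\subseteq G$ be a code with $d_\Gamma(c,c')\geq d$ for all distinct $c,c'\in C$. Let $H$ be a subgroup of $G$, let $X=\{Ha_1,\dots,Ha_m\}$ be the set of right cosets of $H$ in $G$ (with a fixed ordering), and for $g\in G$ let $P_g$ be the $m\times m$ matrix whose $(i,j)$ entry is $1$ if $Ha_ig=Ha_j$ and $0$ otherwise. Put $r=\lfloor\frac{d-1}{2}\rfloor$, $T=S^{r}\cup\{\xi\}$ where $S^r=\{s_1\cdots s_t\mid s_1,\dots,s_t\in S,\ 1\leq t\leq r\}$, and $A=\sum_{t\in T}P_t$. Then the optimal value of the integer program $$\text{maximize } \sum_{i=1}^{m}x_i\quad\text{subject to}\quad A(x_1,\dots,x_m)^t\leq |H|\,\mathbf{1},\quad x_i\in\mathbb{Z},\ x_i\geq 0\ (1\leq i\leq m),$$ where $\mathbf{1}$ is the all-ones column vector of length $m$ and the inequality is entrywise, is an upper bound on $|C|$. -}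

module Defs where

open import Level using (0ℓ)
open import Data.Nat using (ℕ; zero; suc; _+_; _*_; _≤_; _<_)
open import Data.Fin using (Fin; zero; suc)
open import Data.Fin.Subset using (Subset; _∈_; _∉_; ∣_∣; Nonempty)
open import Data.Fin.Subset.Properties using (_∈?_)
open import Data.Product using (Σ; ∃; _×_; _,_)
open import Data.Sum using (_⊎_)
open import Relation.Nullary using (¬_; yes; no)
open import Relation.Binary.PropositionalEquality using (_≡_)
open import Algebra.Structures using (IsGroup)

-- A finite group of order n: carrier Fin n (every finite group is
-- isomorphic to one of this form), with propositional equality.
record FinGroup : Set where
  field
    n       : ℕ
    _∙_     : Fin n → Fin n → Fin n
    ξ       : Fin n
    _⁻¹     : Fin n → Fin n
    isGroup : IsGroup _≡_ _∙_ ξ _⁻¹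
  infixl 7 _∙_
  infix 8 _⁻¹

module _ (G : FinGroup) where
  open FinGroup G

  ∑ : {k : ℕ} → (Fin k → ℕ) → ℕ
  ∑ {zero}  f = 0
  ∑ {suc k} f = f zero + ∑ {k} (λ i → f (suc i))

  Adj : Subset n → Fin n → Fin n → Set
  Adj S g h = (g ∙ h ⁻¹) ∈ S

  data Walk (S : Subset n) : ℕ → Fin n → Fin n → Set where
    here : ∀ {g} → Walk S zero g g
    step : ∀ {k g h u} → Adj S g h → Walk S k h u → Walk S (suc k) g u

  -- d_Γ(g,h) ≥ d  (the graph distance being the least walk length, ∞ if none)
  DistGE : Subset n → Fin n → Fin n → ℕ → Set
  DistGE S g h d = ∀ k → k < d → ¬ Walk S k g h

  IsSubgroup : Subset n → Set
  IsSubgroup H = (ξ ∈ H) × (∀ x y → x ∈ H → y ∈ H → (x ∙ y) ∈ H)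
                 × (∀ x → x ∈ H → (x ⁻¹) ∈ H)

  SameRightCoset : Subset n → Fin n → Fin n → Set
  SameRightCoset H a b = (a ∙ b ⁻¹) ∈ H

  -- a : Fin m → G lists representatives of all right cosets of H, each once:
  -- X = {Ha₁,…,Haₘ} with this fixed ordering.
  IsRightTransversal : Subset n → (m : ℕ) → (Fin m → Fin n) → Set
  IsRightTransversal H m a =
    (∀ i j → SameRightCoset H (a i) (a j) → i ≡ j)
    × (∀ g → ∃ λ i → SameRightCoset H g (a i))

  P : Subset n → {m : ℕ} → (Fin m → Fin n) → Fin n → Fin m → Fin m → ℕ
  P H a g i j with (a i ∙ g ∙ (a j) ⁻¹) ∈? H
  ... | yes _ = 1
  ... | no  _ = 0

  prod : {k : ℕ} → (Fin (suc k) → Fin n) → Fin n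
  prod {zero}  w = w zero
  prod {suc k} w = w zero ∙ prod {k} (λ i → w (suc i))

  InPow : Subset n → ℕ → Fin n → Set
  InPow S r g = ∃ λ k → (suc k ≤ r) × Σ (Fin (suc k) → Fin n)
                  (λ w → (∀ i → w i ∈ S) × prod w ≡ g)

  IsBallSet : Subset n → ℕ → Subset n → Set
  IsBallSet S r T = ∀ g → (g ∈ T → InPow S r g ⊎ g ≡ ξ) × (InPow S r g ⊎ g ≡ ξ → g ∈ T)

  Amat : Subset n → {m : ℕ} → (Fin m → Fin n) → Subset n → Fin m → Fin m → ℕ
  Amat H a T i j = ∑ (λ t → indic t * P H a t i j)
    where
      indic : Fin n → ℕ
      indic t with t ∈? T
      ... | yes _ = 1
      ... | no  _ = 0

  Feasible : {m : ℕ} → (Fin m → Fin m → ℕ) → ℕ → (Fin m → ℕ) → Set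
  Feasible A b x = ∀ i → ∑ (λ j → A i j * x j) ≤ b

  IsOptimalValue : {m : ℕ} → (Fin m → Fin m → ℕ) → ℕ → ℕ → Set
  IsOptimalValue {m} A b opt =
    (Σ (Fin m → ℕ) λ x → Feasible A b x × ∑ x ≡ opt)
    × (∀ x → Feasible A b x → ∑ x ≤ opt)

-- Put x j = ∣ C ∩ (a j)⁻¹ H ∣; the left cosets (a j)⁻¹ H cover G, so ∣ C ∣ ≤ ∑ x. Row i of A x sums
-- 𝟙[a i t (a j)⁻¹ ∈ H] 𝟙[a j g ∈ H] over t ∈ T, g ∈ C and j: for fixed (t , g) at most one j contributes,
-- and only if a i t g ∈ H. As 2 r < d, the translates T g of distinct codewords are disjoint, so
-- (t , g) ↦ a i t g is injective on T × C and the row is at most ∣ H ∣.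

module Submission where

open import Defs
open import Data.Nat using (ℕ; _≤_; _∸_; _/_)
open import Data.Fin using (Fin)
open import Data.Fin.Subset using (Subset; _∈_; _∉_; ∣_∣; Nonempty)
open import Relation.Binary.PropositionalEquality using (_≡_; _≢_)

open import Level using (0ℓ)
open import Data.Bool using (if_then_else_)
open import Data.Nat using (zero; suc; _+_; _*_; _<_; z≤n; s≤s)
open import Data.Nat.Properties
  using (+-comm; *-comm; +-identityʳ; m≤m+n; m≤n+m; ≤-reflexive; ≤-trans; ≤-<-trans; +-mono-≤; +-*-semiring; module ≤-Reasoning)
open import Data.Nat.DivMod using (m/n*n≤m)
open import Data.Fin using () renaming (zero to fzero; suc to fsuc)
open import Data.Fin.Properties using (_≟_; any?; suc-injective)
open import Data.Fin.Subset using (inside; outside)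
open import Data.Fin.Subset.Properties using (_∈?_)
open import Data.Vec using (_∷_; [])
open import Data.Product using (∃; _×_; _,_; proj₁; proj₂)
open import Data.Sum using (inj₁; inj₂)
open import Function using (_∘_)
open import Relation.Nullary using (¬_; Dec; does; yes; no; contradiction)
open import Relation.Nullary.Decidable using (_×-dec_)
open import Relation.Binary.PropositionalEquality using (refl; sym; trans; cong; cong₂; subst; module ≡-Reasoning)
open import Algebra.Bundles using (Group)
open import Algebra.Structures using (IsGroup)
import Algebra.Properties.Group as GroupProperties
open import Algebra.Properties.Semiring.Sum +-*-semiring using (sum; sum-cong-≗; ∑-comm; *-distribˡ-sum; *-distribʳ-sum)

-- Not defined by matching, so it unfolds to a function of `does A?` alone: 𝟙 (suc i ∈? x ∷ p) and 𝟙 (i ∈? p)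
-- are then definitionally equal, although their implicit propositions differ.
𝟙 : {A : Set} → Dec A → ℕ
𝟙 A? = if does A? then 1 else 0

𝟙-yes : {A : Set} (A? : Dec A) → A → 𝟙 A? ≡ 1
𝟙-yes (yes _) _ = refl
𝟙-yes (no ¬a) a = contradiction a ¬a

𝟙-×-dec : {A B : Set} (A? : Dec A) (B? : Dec B) → 𝟙 A? * 𝟙 B? ≡ 𝟙 (A? ×-dec B?)
𝟙-×-dec (yes _) (yes _) = refl
𝟙-×-dec (yes _) (no _)  = refl
𝟙-×-dec (no _)  _       = refl

m/2+m/2≤m : ∀ m → m / 2 + m / 2 ≤ m
m/2+m/2≤m m = subst (_≤ m) (trans (*-comm (m / 2) 2) (cong (m / 2 +_) (+-identityʳ (m / 2)))) (m/n*n≤m m 2)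

radius+radius<d : ∀ d → 1 ≤ d → (d ∸ 1) / 2 + (d ∸ 1) / 2 < d
radius+radius<d (suc d) _ = s≤s (m/2+m/2≤m d)

module _ (G : FinGroup) where
  open FinGroup G

  ∑≡sum : ∀ {k} (f : Fin k → ℕ) → ∑ G f ≡ sum f
  ∑≡sum {zero}  f = refl
  ∑≡sum {suc k} f = cong (f fzero +_) (∑≡sum (f ∘ fsuc))

  ∑∑≡sum∑ : ∀ {k l} (f : Fin k → Fin l → ℕ) → ∑ G (λ i → ∑ G (f i)) ≡ sum (λ i → sum (f i))
  ∑∑≡sum∑ f = trans (∑≡sum (λ i → ∑ G (f i))) (sum-cong-≗ (λ i → ∑≡sum (f i)))

  ∑-cong : ∀ {k} {f g : Fin k → ℕ} → (∀ i → f i ≡ g i) → ∑ G f ≡ ∑ G g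
  ∑-cong {zero}  f≗g = refl
  ∑-cong {suc k} f≗g = cong₂ _+_ (f≗g fzero) (∑-cong (f≗g ∘ fsuc))

  ∑-mono-≤ : ∀ {k} {f g : Fin k → ℕ} → (∀ i → f i ≤ g i) → ∑ G f ≤ ∑ G g
  ∑-mono-≤ {zero}  f≤g = z≤n
  ∑-mono-≤ {suc k} f≤g = +-mono-≤ (f≤g fzero) (∑-mono-≤ (f≤g ∘ fsuc))

  f≤∑f : ∀ {k} (f : Fin k → ℕ) i → f i ≤ ∑ G f
  f≤∑f f fzero    = m≤m+n _ _
  f≤∑f f (fsuc i) = ≤-trans (f≤∑f (f ∘ fsuc) i) (m≤n+m _ _)

  ∑-swap : ∀ {k l} (f : Fin k → Fin l → ℕ) → ∑ G (λ i → ∑ G (f i)) ≡ ∑ G (λ j → ∑ G (λ i → f i j))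
  ∑-swap f = trans (∑∑≡sum∑ f) (trans (∑-comm f) (sym (∑∑≡sum∑ (λ j i → f i j))))

  ∑*∑ : ∀ {k l} (f : Fin k → ℕ) (g : Fin l → ℕ) → ∑ G f * ∑ G g ≡ ∑ G (λ i → ∑ G (λ j → f i * g j))
  ∑*∑ f g = begin
    ∑ G f * ∑ G g                      ≡⟨ cong₂ _*_ (∑≡sum f) (∑≡sum g) ⟩
    sum f * sum g                      ≡⟨ *-distribʳ-sum (sum g) f ⟩
    sum (λ i → f i * sum g)            ≡⟨ sum-cong-≗ (λ i → *-distribˡ-sum (f i) g) ⟩
    sum (λ i → sum (λ j → f i * g j))  ≡⟨ sym (∑∑≡sum∑ (λ i j → f i * g j)) ⟩
    ∑ G (λ i → ∑ G (λ j → f i * g j))  ∎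
    where open ≡-Reasoning

  ∑𝟙∈≡∣∣ : ∀ {k} (p : Subset k) → ∑ G (λ i → 𝟙 (i ∈? p)) ≡ ∣ p ∣
  ∑𝟙∈≡∣∣ []            = refl
  ∑𝟙∈≡∣∣ (inside ∷ p)  = cong suc (∑𝟙∈≡∣∣ p)
  ∑𝟙∈≡∣∣ (outside ∷ p) = ∑𝟙∈≡∣∣ p

  ∑𝟙≡0 : ∀ {k} {B : Fin k → Set} (B? : ∀ i → Dec (B i)) → (∀ i → ¬ B i) → ∑ G (𝟙 ∘ B?) ≡ 0
  ∑𝟙≡0 {zero}  B? ¬B = refl
  ∑𝟙≡0 {suc k} B? ¬B with B? fzero
  ... | yes b = contradiction b (¬B fzero)
  ... | no _  = ∑𝟙≡0 (B? ∘ fsuc) (¬B ∘ fsuc)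

  ∑𝟙≤1 : ∀ {k} {B : Fin k → Set} (B? : ∀ i → Dec (B i)) → (∀ {i j} → B i → B j → i ≡ j) → ∑ G (𝟙 ∘ B?) ≤ 1
  ∑𝟙≤1 {zero}  B? unique = z≤n
  ∑𝟙≤1 {suc k} B? unique with B? fzero
  ... | yes b = ≤-reflexive (cong suc (∑𝟙≡0 (B? ∘ fsuc) (λ i b′ → 0≢suc (unique b b′))))
    where
    0≢suc : ∀ {i : Fin k} → fzero ≢ fsuc i
    0≢suc ()
  ... | no _  = ∑𝟙≤1 (B? ∘ fsuc) (λ b b′ → suc-injective (unique b b′))

  ∑𝟙≤𝟙 : ∀ {k} {A : Set} {B : Fin k → Set} (A? : Dec A) (B? : ∀ i → Dec (B i)) →
         (∀ {i} → B i → A) → (∀ {i j} → B i → B j → i ≡ j) → ∑ G (𝟙 ∘ B?) ≤ 𝟙 A?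
  ∑𝟙≤𝟙 (yes _) B? B⇒A unique = ∑𝟙≤1 B? unique
  ∑𝟙≤𝟙 (no ¬a) B? B⇒A unique = ≤-reflexive (∑𝟙≡0 B? (λ i → ¬a ∘ B⇒A))

  ∑∑𝟙≤𝟙 : ∀ {k l} {A : Set} {B : Fin k → Fin l → Set} (A? : Dec A) (B? : ∀ i j → Dec (B i j)) →
          (∀ {i j} → B i j → A) → (∀ {i j i′ j′} → B i j → B i′ j′ → i ≡ i′ × j ≡ j′) →
          ∑ G (λ i → ∑ G (λ j → 𝟙 (B? i j))) ≤ 𝟙 A?
  ∑∑𝟙≤𝟙 A? B? B⇒A unique = ≤-trans
    (∑-mono-≤ (λ i → ∑𝟙≤𝟙 (any? (B? i)) (B? i) (_ ,_) (λ b b′ → proj₂ (unique b b′))))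
    (∑𝟙≤𝟙 A? (any? ∘ B?) (B⇒A ∘ proj₂) (λ (_ , b) (_ , b′) → proj₁ (unique b b′)))

  𝟙≤∑𝟙×-dec : ∀ {k} {A : Set} {B : Fin k → Set} (A? : Dec A) (B? : ∀ i → Dec (B i)) →
              (A → ∃ B) → 𝟙 A? ≤ ∑ G (λ i → 𝟙 (A? ×-dec B? i))
  𝟙≤∑𝟙×-dec (no _)  B? A⇒∃B = z≤n
  𝟙≤∑𝟙×-dec (yes a) B? A⇒∃B =
    let (i , b) = A⇒∃B a in
    subst (_≤ ∑ G (λ i → 𝟙 (yes a ×-dec B? i))) (𝟙-yes (yes a ×-dec B? i) (a , b)) (f≤∑f (λ i → 𝟙 (yes a ×-dec B? i)) i)

  -- Insert ∑ₓ 𝟙 (x ≡ f i j) and sum over x first.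
  ∑∑𝟙≤∣∣ : ∀ {k l N} {B : Fin k → Fin l → Set} (B? : ∀ i j → Dec (B i j))
           (p : Subset N) (f : Fin k → Fin l → Fin N) → (∀ {i j} → B i j → f i j ∈ p) →
           (∀ {i j i′ j′} → B i j → B i′ j′ → f i j ≡ f i′ j′ → i ≡ i′ × j ≡ j′) →
           ∑ G (λ i → ∑ G (λ j → 𝟙 (B? i j))) ≤ ∣ p ∣
  ∑∑𝟙≤∣∣ B? p f B⇒f∈p injective = begin
    ∑ G (λ i → ∑ G (λ j → 𝟙 (B? i j)))
      ≤⟨ ∑-mono-≤ (λ i → ∑-mono-≤ (λ j → 𝟙≤∑𝟙×-dec (B? i j) (_≟ f i j) (λ _ → f i j , refl))) ⟩
    ∑ G (λ i → ∑ G (λ j → ∑ G (λ x → 𝟙 (B? i j ×-dec x ≟ f i j))))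
      ≡⟨ ∑-cong (λ i → ∑-swap (λ j x → 𝟙 (B? i j ×-dec x ≟ f i j))) ⟩
    ∑ G (λ i → ∑ G (λ x → ∑ G (λ j → 𝟙 (B? i j ×-dec x ≟ f i j))))
      ≡⟨ ∑-swap (λ i x → ∑ G (λ j → 𝟙 (B? i j ×-dec x ≟ f i j))) ⟩
    ∑ G (λ x → ∑ G (λ i → ∑ G (λ j → 𝟙 (B? i j ×-dec x ≟ f i j))))
      ≤⟨ ∑-mono-≤ (λ x → ∑∑𝟙≤𝟙 (x ∈? p) (λ i j → B? i j ×-dec x ≟ f i j)
                   (λ { (b , refl) → B⇒f∈p b })
                   (λ (b , x≡f) (b′ , x≡f′) → injective b b′ (trans (sym x≡f) x≡f′))) ⟩
    ∑ G (λ x → 𝟙 (x ∈? p))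
      ≡⟨ ∑𝟙∈≡∣∣ p ⟩
    ∣ p ∣ ∎
    where open ≤-Reasoning

  ∣∣≤∑∑𝟙 : ∀ {k l} (p : Subset k) {B : Fin l → Fin k → Set} (B? : ∀ j i → Dec (B j i)) →
           (∀ i → ∃ λ j → B j i) → ∣ p ∣ ≤ ∑ G (λ j → ∑ G (λ i → 𝟙 (i ∈? p ×-dec B? j i)))
  ∣∣≤∑∑𝟙 p B? covered = begin
    ∣ p ∣                                               ≡⟨ sym (∑𝟙∈≡∣∣ p) ⟩
    ∑ G (λ i → 𝟙 (i ∈? p))                              ≤⟨ ∑-mono-≤ (λ i → 𝟙≤∑𝟙×-dec (i ∈? p) (λ j → B? j i) (λ _ → covered i)) ⟩
    ∑ G (λ i → ∑ G (λ j → 𝟙 (i ∈? p ×-dec B? j i)))     ≡⟨ ∑-swap (λ i j → 𝟙 (i ∈? p ×-dec B? j i)) ⟩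
    ∑ G (λ j → ∑ G (λ i → 𝟙 (i ∈? p ×-dec B? j i)))     ∎
    where open ≤-Reasoning

  group : Group 0ℓ 0ℓ
  group = record { Carrier = Fin n ; _≈_ = _≡_ ; _∙_ = _∙_ ; ε = ξ ; _⁻¹ = _⁻¹ ; isGroup = isGroup }

  open IsGroup isGroup using (assoc; identityˡ)
  open GroupProperties group using (⁻¹-involutive; ⁻¹-anti-homo-∙; //-rightDividesˡ; //-rightDividesʳ; ∙-cancelˡ; ∙-cancelʳ)

  x∙y⁻¹∙[y∙z]≡x∙z : ∀ x y z → x ∙ y ⁻¹ ∙ (y ∙ z) ≡ x ∙ z
  x∙y⁻¹∙[y∙z]≡x∙z x y z = begin
    x ∙ y ⁻¹ ∙ (y ∙ z)    ≡⟨ sym (assoc (x ∙ y ⁻¹) y z) ⟩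
    x ∙ y ⁻¹ ∙ y ∙ z      ≡⟨ cong (_∙ z) (//-rightDividesˡ y x) ⟩
    x ∙ z                 ∎
    where open ≡-Reasoning

  [x∙y⁻¹]⁻¹≡y∙x⁻¹ : ∀ x y → (x ∙ y ⁻¹) ⁻¹ ≡ y ∙ x ⁻¹
  [x∙y⁻¹]⁻¹≡y∙x⁻¹ x y = trans (⁻¹-anti-homo-∙ x (y ⁻¹)) (cong (_∙ x ⁻¹) (⁻¹-involutive y))

  walk-++ : ∀ {S k l g h u} → Walk G S k g h → Walk G S l h u → Walk G S (k + l) g u
  walk-++ here         w′ = w′
  walk-++ (step adj w) w′ = step adj (walk-++ w w′)

  module _ {S : Subset n} (S-symmetric : ∀ s → s ∈ S → (s ⁻¹) ∈ S) where

    Adj-sym : ∀ {g h} → Adj G S g h → Adj G S h g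
    Adj-sym {g} {h} adj = subst (_∈ S) ([x∙y⁻¹]⁻¹≡y∙x⁻¹ g h) (S-symmetric _ adj)

    walk-reverse : ∀ {k g h} → Walk G S k g h → Walk G S k h g
    walk-reverse here = here
    walk-reverse {suc k} {g} {h} (step adj w) =
      subst (λ l → Walk G S l h g) (+-comm k 1) (walk-++ (walk-reverse w) (step (Adj-sym adj) here))

  prod-walk : ∀ {S k} (w : Fin (suc k) → Fin n) → (∀ i → w i ∈ S) → ∀ u → Walk G S (suc k) (prod G w ∙ u) u
  prod-walk {S} {zero}  w w∈S u = step (subst (_∈ S) (sym (//-rightDividesʳ u (w fzero))) (w∈S fzero)) here
  prod-walk {S} {suc k} w w∈S u = step first (prod-walk (w ∘ fsuc) (w∈S ∘ fsuc) u)
    where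
    rest : Fin n
    rest = prod G (w ∘ fsuc)
    first : Adj G S (w fzero ∙ rest ∙ u) (rest ∙ u)
    first = subst (_∈ S) (sym (trans (cong (_∙ (rest ∙ u) ⁻¹) (assoc (w fzero) rest u))
                                     (//-rightDividesʳ (rest ∙ u) (w fzero))))
                  (w∈S fzero)

  ball-walk : ∀ {S r T t} → IsBallSet G S r T → t ∈ T → ∃ λ k → k ≤ r × (∀ u → Walk G S k (t ∙ u) u)
  ball-walk {S} {t = t} T-ball t∈T with proj₁ (T-ball t) t∈T
  ... | inj₂ refl = 0 , z≤n , λ u → subst (λ v → Walk G S 0 v u) (sym (identityˡ u)) here
  ... | inj₁ (k , 1+k≤r , w , w∈S , refl) = suc k , 1+k≤r , prod-walk w w∈S

  -- Two codewords whose translates by ball elements meet are joined by a walk of length ≤ 2r < d.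
  ball-packing : ∀ {S r T C d} → (∀ s → s ∈ S → (s ⁻¹) ∈ S) →
                 (∀ c c′ → c ∈ C → c′ ∈ C → c ≢ c′ → DistGE G S c c′ d) →
                 IsBallSet G S r T → r + r < d →
                 ∀ {t t′ g g′} → t ∈ T → t′ ∈ T → g ∈ C → g′ ∈ C → t ∙ g ≡ t′ ∙ g′ → t ≡ t′ × g ≡ g′
  ball-packing {S} S-symmetric C-separated T-ball 2r<d {t} {t′} {g} {g′} t∈T t′∈T g∈C g′∈C tg≡t′g′
    with g ≟ g′
  ... | yes refl = ∙-cancelʳ g t t′ tg≡t′g′ , refl
  ... | no g≢g′ =
    let (k , k≤r , tu⇝u) = ball-walk T-ball t∈T
        (k′ , k′≤r , t′u⇝u) = ball-walk T-ball t′∈T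
        g⇝g′ : Walk G S (k + k′) g g′
        g⇝g′ = walk-++ (walk-reverse S-symmetric (tu⇝u g))
                       (subst (λ v → Walk G S k′ v g′) (sym tg≡t′g′) (t′u⇝u g′))
    in contradiction g⇝g′ (C-separated g g′ g∈C g′∈C g≢g′ (k + k′) (≤-<-trans (+-mono-≤ k≤r k′≤r) 2r<d))

  module _ {H : Subset n} (H-subgroup : IsSubgroup G H) where
    private
      inverse-closed : ∀ x → x ∈ H → (x ⁻¹) ∈ H
      inverse-closed = proj₂ (proj₂ H-subgroup)
      product-closed : ∀ x y → x ∈ H → y ∈ H → (x ∙ y) ∈ H
      product-closed = proj₁ (proj₂ H-subgroup)

    x∙y⁻¹∈H⇒y∙z∈H⇒x∙z∈H : ∀ {x y z} → (x ∙ y ⁻¹) ∈ H → (y ∙ z) ∈ H → (x ∙ z) ∈ H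
    x∙y⁻¹∈H⇒y∙z∈H⇒x∙z∈H {x} {y} {z} p q = subst (_∈ H) (x∙y⁻¹∙[y∙z]≡x∙z x y z) (product-closed _ _ p q)

    module _ {m} {a : Fin m → Fin n} (transversal : IsRightTransversal G H m a) where

      transversal-unique : ∀ {y i j} → (y ∙ a i ⁻¹) ∈ H → (y ∙ a j ⁻¹) ∈ H → i ≡ j
      transversal-unique {y} {i} {j} p q = proj₁ transversal i j (x∙y⁻¹∈H⇒y∙z∈H⇒x∙z∈H a-i∙y⁻¹∈H q)
        where
        a-i∙y⁻¹∈H : (a i ∙ y ⁻¹) ∈ H
        a-i∙y⁻¹∈H = subst (_∈ H) ([x∙y⁻¹]⁻¹≡y∙x⁻¹ y (a i)) (inverse-closed _ p)

      transversal-cover : ∀ g → ∃ λ j → (a j ∙ g) ∈ H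
      transversal-cover g =
        let (j , p) = proj₂ transversal (g ⁻¹) in
        j , subst (_∈ H) (trans ([x∙y⁻¹]⁻¹≡y∙x⁻¹ (g ⁻¹) (a j)) (cong (a j ∙_) (⁻¹-involutive g))) (inverse-closed _ p)

  -- Defs hides the weight of t in the sum defining Amat behind a local `with`; this names it.
  summand : ∀ {k} {X : ℕ} {f : Fin k → ℕ} → X ≡ ∑ G f → Fin k → ℕ
  summand {f = f} _ = f

  Amat≡∑𝟙 : ∀ H {m} (a : Fin m → Fin n) T i j →
            Amat G H a T i j ≡ ∑ G (λ t → 𝟙 (t ∈? T ×-dec (a i ∙ t ∙ a j ⁻¹) ∈? H))
  Amat≡∑𝟙 H a T i j = ∑-cong entry
    where
    entry : ∀ t → summand {X = Amat G H a T i j} refl t ≡ 𝟙 (t ∈? T ×-dec (a i ∙ t ∙ a j ⁻¹) ∈? H)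
    entry t with t ∈? T | (a i ∙ t ∙ a j ⁻¹) ∈? H
    ... | yes _ | yes _ = refl
    ... | yes _ | no _  = refl
    ... | no _  | _     = refl

  codewords-in-coset : Subset n → Subset n → ∀ {m} → (Fin m → Fin n) → Fin m → ℕ
  codewords-in-coset C H a j = ∑ G (λ g → 𝟙 (g ∈? C ×-dec (a j ∙ g) ∈? H))

  Amat-row≡ : ∀ C H {m} (a : Fin m → Fin n) T i →
              ∑ G (λ j → Amat G H a T i j * codewords-in-coset C H a j)
              ≡ ∑ G (λ t → ∑ G (λ g → ∑ G (λ j →
                  𝟙 (t ∈? T ×-dec (a i ∙ t ∙ a j ⁻¹) ∈? H) * 𝟙 (g ∈? C ×-dec (a j ∙ g) ∈? H))))
  Amat-row≡ C H {m} a T i = begin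
    ∑ G (λ j → Amat G H a T i j * codewords-in-coset C H a j)
      ≡⟨ ∑-cong (λ j → trans (cong (_* codewords-in-coset C H a j) (Amat≡∑𝟙 H a T i j)) (∑*∑ (A-term j) (x-term j))) ⟩
    ∑ G (λ j → ∑ G (λ t → ∑ G (λ g → A-term j t * x-term j g)))
      ≡⟨ ∑-swap (λ j t → ∑ G (λ g → A-term j t * x-term j g)) ⟩
    ∑ G (λ t → ∑ G (λ j → ∑ G (λ g → A-term j t * x-term j g)))
      ≡⟨ ∑-cong (λ t → ∑-swap (λ j g → A-term j t * x-term j g)) ⟩
    ∑ G (λ t → ∑ G (λ g → ∑ G (λ j → A-term j t * x-term j g))) ∎
    where
    open ≡-Reasoning
    A-term : Fin m → Fin n → ℕ
    A-term j t = 𝟙 (t ∈? T ×-dec (a i ∙ t ∙ a j ⁻¹) ∈? H)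
    x-term : Fin m → Fin n → ℕ
    x-term j g = 𝟙 (g ∈? C ×-dec (a j ∙ g) ∈? H)

  codewords-in-coset-feasible :
    ∀ {S r d C H m a T} → (∀ s → s ∈ S → (s ⁻¹) ∈ S) →
    (∀ c c′ → c ∈ C → c′ ∈ C → c ≢ c′ → DistGE G S c c′ d) →
    IsSubgroup G H → IsRightTransversal G H m a → IsBallSet G S r T → r + r < d →
    Feasible G (Amat G H a T) ∣ H ∣ (codewords-in-coset C H a)
  codewords-in-coset-feasible {C = C} {H} {a = a} {T}
    S-symmetric C-separated H-subgroup transversal T-ball 2r<d i = begin
    ∑ G (λ j → Amat G H a T i j * codewords-in-coset C H a j)
      ≡⟨ Amat-row≡ C H a T i ⟩
    ∑ G (λ t → ∑ G (λ g → ∑ G (λ j → 𝟙 (A? t j) * 𝟙 (x? j g))))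
      ≤⟨ ∑-mono-≤ (λ t → ∑-mono-≤ (λ g → at-most-one-coset t g)) ⟩
    ∑ G (λ t → ∑ G (λ g → 𝟙 (translate? t g)))
      ≤⟨ ∑∑𝟙≤∣∣ translate? H (λ t g → a i ∙ t ∙ g) proj₂ translate-injective ⟩
    ∣ H ∣ ∎
    where
    open ≤-Reasoning
    A? : ∀ t j → Dec (t ∈ T × (a i ∙ t ∙ a j ⁻¹) ∈ H)
    A? t j = t ∈? T ×-dec (a i ∙ t ∙ a j ⁻¹) ∈? H
    x? : ∀ j g → Dec (g ∈ C × (a j ∙ g) ∈ H)
    x? j g = g ∈? C ×-dec (a j ∙ g) ∈? H
    translate? : ∀ t g → Dec ((t ∈ T × g ∈ C) × (a i ∙ t ∙ g) ∈ H)
    translate? t g = (t ∈? T ×-dec g ∈? C) ×-dec (a i ∙ t ∙ g) ∈? H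

    at-most-one-coset : ∀ t g → ∑ G (λ j → 𝟙 (A? t j) * 𝟙 (x? j g)) ≤ 𝟙 (translate? t g)
    at-most-one-coset t g = subst (_≤ 𝟙 (translate? t g)) (∑-cong (λ j → sym (𝟙-×-dec (A? t j) (x? j g))))
      (∑𝟙≤𝟙 (translate? t g) (λ j → A? t j ×-dec x? j g)
        (λ ((t∈T , p) , (g∈C , q)) → (t∈T , g∈C) , x∙y⁻¹∈H⇒y∙z∈H⇒x∙z∈H H-subgroup p q)
        (λ ((_ , p) , _) ((_ , p′) , _) → transversal-unique H-subgroup transversal p p′))

    translate-injective : ∀ {t g t′ g′} → (t ∈ T × g ∈ C) × (a i ∙ t ∙ g) ∈ H → (t′ ∈ T × g′ ∈ C) × (a i ∙ t′ ∙ g′) ∈ H →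
                          a i ∙ t ∙ g ≡ a i ∙ t′ ∙ g′ → t ≡ t′ × g ≡ g′
    translate-injective {t} {g} {t′} {g′} ((t∈T , g∈C) , _) ((t′∈T , g′∈C) , _) e =
      ball-packing S-symmetric C-separated T-ball 2r<d t∈T t′∈T g∈C g′∈C
        (∙-cancelˡ (a i) (t ∙ g) (t′ ∙ g′) (trans (sym (assoc (a i) t g)) (trans e (assoc (a i) t′ g′))))

theorem2p14 : (G : FinGroup) → let open FinGroup G in
    (S : Subset n) → Nonempty S → (∀ s → s ∈ S → (s ⁻¹) ∈ S) → ξ ∉ S →
    (d : ℕ) → 1 ≤ d →
    (C : Subset n) → (∀ c c′ → c ∈ C → c′ ∈ C → c ≢ c′ → DistGE G S c c′ d) →
    (H : Subset n) → IsSubgroup G H →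
    (m : ℕ) → (a : Fin m → Fin n) → IsRightTransversal G H m a →
    (T : Subset n) → IsBallSet G S ((d ∸ 1) / 2) T →
    (opt : ℕ) → IsOptimalValue G (Amat G H a T) ∣ H ∣ opt →
    ∣ C ∣ ≤ opt
theorem2p14 G S _ S-symmetric _ d 1≤d C C-separated H H-subgroup m a transversal T T-ball opt (_ , opt-is-max) =
  begin
    ∣ C ∣                                 ≤⟨ ∣∣≤∑∑𝟙 G C (λ j g → (a j ∙ g) ∈? H) (transversal-cover G H-subgroup transversal) ⟩
    ∑ G (codewords-in-coset G C H a)      ≤⟨ opt-is-max (codewords-in-coset G C H a) x-feasible ⟩
    opt                                   ∎
  where
  open FinGroup G
  open ≤-Reasoning
  x-feasible : Feasible G (Amat G H a T) ∣ H ∣ (codewords-in-coset G C H a)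
  x-feasible = codewords-in-coset-feasible G S-symmetric C-separated H-subgroup transversal T-ball (radius+radius<d d 1≤d)
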